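{- Let $n \geq 3$, let $T_n = \{k : 2 \leq k \leq n-1,\ k \equiv n+1 \pmod 2\}$ and $m = \lfloor (n-1)/2 \rfloor = |T_n|$. The maps $\mathrm{Sgn\_flip}_k$, $k \in T_n$, are pairwise commuting involutions preserving $\mathfrak{B}_n^>$, hence generate an action of $\mathbb{Z}_2^m$ on $\mathfrak{B}_n^>$. Let $O$ be any orbit of this action. Then there is a non-negative integer $a$ such that $$\sum_{\pi \in O} t^{\mathrm{altruns}_B(\pi)} = t^a (1+t)^m.$$
   Context: $\mathfrak{B}_n$ is the set of signed permutations of $[n]$, written as words $\pi = \pi_1,\ldots,\pi_n$ with $\pi_i \in \{\pm 1,\ldots,\pm n\}$ and $|\pi_1|,\ldots,|\pi_n|$ a permutation of $[n]$; $\overline{a}$ denotes $-a$. $\mathfrak{B}_n^> = \{\pi \in \mathfrak{B}_n : \pi_1 > 0\}$. Set $\pi_0 = 0$. For $1 \leq i \leq n-1$, $\pi$ changes direction at $i$ if $\pi_{i-1} < \pi_i > \pi_{i+1}$ or $\pi_{i-1} > \pi_i < \pi_{i+1}$. $\mathrm{altruns}_B(\pi)$ is $1$ plus the number of indices at which $\pi$ changes direction. For $1 \leq k \leq n$, $\mathrm{Sgn\_flip}_k(\pi) = \pi_1,\ldots,\pi_{k-1},\overline{\pi_k},\ldots,\overline{\pi_n}$. -}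

module Defs where

open import Data.Bool using (Bool; true; false; _∧_; _∨_; if_then_else_)
open import Data.Nat as ℕ using (ℕ; zero; suc; _+_; _∸_; _≤_; _≤ᵇ_)
open import Data.Nat.Combinatorics using (_C_)
open import Data.Integer as ℤ using (ℤ; -_; ∣_∣; +_)
import Data.Integer.Properties as ℤP
open import Data.List using (List; []; _∷_; map; take; drop; _++_; filter; length; deduplicate; concatMap)
import Data.List.Properties as LP
open import Data.List.Relation.Binary.Permutation.Propositional using (_↭_)
open import Data.Product using (_×_)
open import Relation.Nullary.Decidable using (⌊_⌋)
open import Relation.Binary.PropositionalEquality using (_≡_)
open import Data.Empty using (⊥)

range : ℕ → ℕ → List ℕ
range a b = go a (suc b ∸ a)
  where
  go : ℕ → ℕ → List ℕ
  go x zero = []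
  go x (suc k) = x ∷ go (suc x) k

IsSignedPerm : ℕ → List ℤ → Set
IsSignedPerm n π = (length π ≡ n) × (map ∣_∣ π ↭ range 1 n)

PositiveHead : List ℤ → Set
PositiveHead [] = ⊥
PositiveHead (x ∷ _) = ℤ.0ℤ ℤ.< x

IsSignedPerm> : ℕ → List ℤ → Set
IsSignedPerm> n π = IsSignedPerm n π × PositiveHead π

-- Sgn_flip_k (1-based k): keep π_1..π_{k-1}, negate π_k..π_n
sgnFlip : ℕ → List ℤ → List ℤ
sgnFlip k π = take (k ∸ 1) π ++ map -_ (drop (k ∸ 1) π)

changesDir : ℤ → ℤ → ℤ → Bool
changesDir x y z = (⌊ x ℤ.<? y ⌋ ∧ ⌊ z ℤ.<? y ⌋) ∨ (⌊ y ℤ.<? x ⌋ ∧ ⌊ y ℤ.<? z ⌋)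

countChanges : List ℤ → ℕ
countChanges (x ∷ y ∷ z ∷ rest) =
  (if changesDir x y z then 1 else 0) + countChanges (y ∷ z ∷ rest)
countChanges _ = 0

-- altruns_B(π) = 1 + #{1 ≤ i ≤ n-1 : π changes direction at i}, with π_0 = 0
altrunsB : List ℤ → ℕ
altrunsB π = 1 + countChanges (+ 0 ∷ π)

Tset : ℕ → List ℕ
Tset n = filter (λ k → (k ℕ.% 2) ℕ.≟ ((n + 1) ℕ.% 2)) (range 2 (n ∸ 1))

-- all elements of ℤ₂^m, as 0/1 words of length m
allBools : ℕ → List (List Bool)
allBools zero = [] ∷ []
allBools (suc m) = concatMap (λ bs → (false ∷ bs) ∷ (true ∷ bs) ∷ []) (allBools m)

act : List ℕ → List Bool → List ℤ → List ℤ
act (k ∷ ks) (b ∷ bs) π = act ks bs (if b then sgnFlip k π else π)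
act _ _ π = π

-- the orbit of π under the ℤ₂^m-action generated by Sgn_flip_k, k ∈ T_n
-- (as a duplicate-free list, i.e. a finite set)
orbit : ℕ → List ℤ → List (List ℤ)
orbit n π = deduplicate (LP.≡-dec ℤ._≟_)
  (map (λ e → act (Tset n) e π) (allBools (length (Tset n))))

-- coefficient of t^j in Σ_{σ ∈ O} t^{altruns_B σ}
orbitCoeff : List (List ℤ) → ℕ → ℕ
orbitCoeff O j = length (filter (λ σ → altrunsB σ ℕ.≟ j) O)

-- coefficient of t^j in t^a (1+t)^m
shiftedBinomCoeff : ℕ → ℕ → ℕ → ℕ
shiftedBinomCoeff a m j = if a ≤ᵇ j then m C (j ∸ a) else 0

module Submission where

-- Negating the suffix of 0, π₁, …, πₙ from π_k on only affects the direction changes at the positions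
-- k − 1 and k: later positions only see negated entries, and negating a whole triple preserves a change
-- of direction. As neighbouring entries have distinct absolute values, each indicator is a xor of two
-- comparisons, and the flip changes the number of changes at k − 1 and k by exactly one. For k ∈ Tₙ these
-- pairs of positions are disjoint, so altruns_B(e · π) = a + (Hamming distance from e to a fixed d ∈ ℤ₂^m),
-- and summing over e gives t^a (1 + t)^m. The action is free because π has no zero entry, so the orbit is
-- an injective image of ℤ₂^m.

open import Defs
open import Data.Nat using (ℕ; zero; suc; _+_; _*_; _∸_; _≤_; s≤s; z≤n; _%_; _/_; _≟_)
import Data.Nat.Properties as ℕ
open import Data.Nat.DivMod using ([m+n]%n≡m%n; [m+kn]%n≡m%n; m*n%n≡0; m*n/n≡m; m/n≡1+[m∸n]/n)
open import Data.Nat.Combinatorics using (_C_; nCk+nC[k+1]≡[n+1]C[k+1])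
open import Algebra.Properties.CommutativeSemigroup ℕ.+-commutativeSemigroup using (interchange)
open import Data.Integer using (ℤ; +0; +[1+_]; -[1+_]; -_; ∣_∣; _<?_)
import Data.Integer.Properties as ℤ
open import Data.Bool using (Bool; true; false; not; _xor_; _∧_; _∨_; if_then_else_)
import Data.Bool.Properties as Bool
open import Data.List using (List; []; _∷_; _++_; map; take; drop; filter; length; concatMap; deduplicate)
import Data.List.Properties as List
open import Data.List.Membership.Propositional using (_∈_; find)
open import Data.List.Membership.Propositional.Properties using (∈-concatMap⁻)
open import Data.List.Relation.Unary.Any using (here; there)
open import Data.List.Relation.Unary.All as All using (All; []; _∷_)
import Data.List.Relation.Unary.All.Properties as All
open import Data.List.Relation.Unary.AllPairs using ([]; _∷_)
open import Data.List.Relation.Unary.Unique.Propositional using (Unique)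
open import Data.List.Relation.Binary.Permutation.Propositional using (_↭_; prep; ↭-sym; ↭⇒↭ₛ)
import Data.List.Relation.Binary.Permutation.Setoid.Properties as Perm
open import Data.Product using (∃; ∃₂; _×_; _,_)
open import Data.Empty using (⊥-elim)
open import Function using (_∘_)
open import Relation.Nullary using (does; yes; no; ¬?)
open import Relation.Nullary.Decidable using (⌊_⌋)
open import Relation.Binary.Definitions using (DecidableEquality; tri<; tri≈; tri>)
open import Relation.Binary.PropositionalEquality
  using (_≡_; _≢_; refl; sym; trans; cong; cong₂; subst; setoid)
open Relation.Binary.PropositionalEquality.≡-Reasoning

data Parity : ℕ → Set where
  even : ∀ m → Parity (m * 2)
  odd  : ∀ m → Parity (suc (m * 2))

parity : ∀ n → Parity n
parity zero = even 0
parity (suc n) with parity n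
... | even m = odd m
... | odd m = even (suc m)

countFrom : ℕ → ℕ → List ℕ
countFrom x zero = []
countFrom x (suc c) = x ∷ countFrom (suc x) c

stride2 : ℕ → ℕ → List ℕ
stride2 x zero = []
stride2 x (suc j) = x ∷ stride2 (2 + x) j

suc[x+c]∸x≡suc[c] : ∀ x c → suc (x + c) ∸ x ≡ suc c
suc[x+c]∸x≡suc[c] x c = trans (cong (_∸ x) (sym (ℕ.+-suc x c))) (ℕ.m+n∸m≡n x (suc c))

range-cons : ∀ x c → range x (x + suc c) ≡ x ∷ range (suc x) (suc x + c)
range-cons x c rewrite suc[x+c]∸x≡suc[c] x (suc c) | suc[x+c]∸x≡suc[c] x c = refl

range-countFrom : ∀ x c → range x (x + c) ≡ countFrom x (suc c)
range-countFrom x zero rewrite suc[x+c]∸x≡suc[c] x 0 = refl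
range-countFrom x (suc c) = trans (range-cons x c) (cong (x ∷_) (range-countFrom (suc x) c))

[2+x]%2≡x%2 : ∀ x → (2 + x) % 2 ≡ x % 2
[2+x]%2≡x%2 x = trans (cong (_% 2) (ℕ.+-comm 2 x)) ([m+n]%n≡m%n x 2)

filter-parity-countFrom : ∀ {q} x m → x % 2 ≡ q → suc x % 2 ≢ q →
  filter (λ k → k % 2 ≟ q) (countFrom x (suc (m * 2))) ≡ stride2 x (suc m)
filter-parity-countFrom {q} x zero x≡q sx≢q = List.filter-accept (λ k → k % 2 ≟ q) {x} {[]} x≡q
filter-parity-countFrom {q} x (suc m) x≡q sx≢q = begin
  filter P? (x ∷ suc x ∷ countFrom (2 + x) (suc (m * 2)))
    ≡⟨ List.filter-accept P? {x} x≡q ⟩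
  x ∷ filter P? (suc x ∷ countFrom (2 + x) (suc (m * 2)))
    ≡⟨ cong (x ∷_) (List.filter-reject P? {suc x} sx≢q) ⟩
  x ∷ filter P? (countFrom (2 + x) (suc (m * 2)))
    ≡⟨ cong (x ∷_) rest ⟩
  x ∷ stride2 (2 + x) (suc m) ∎
  where
  P? = λ k → k % 2 ≟ q
  rest = filter-parity-countFrom (2 + x) m (trans ([2+x]%2≡x%2 x) x≡q)
           (λ e → sx≢q (trans (sym ([2+x]%2≡x%2 (suc x))) e))

Tset-odd : ∀ m → Tset (3 + m * 2) ≡ stride2 2 (suc m)
Tset-odd m = begin
  filter P? (range 2 (2 + m * 2))        ≡⟨ cong (filter P?) (range-countFrom 2 (m * 2)) ⟩
  filter P? (countFrom 2 (suc (m * 2)))  ≡⟨ filter-parity-countFrom 2 m (sym q≡0) 3≢q ⟩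
  stride2 2 (suc m)                      ∎
  where
  q = ((3 + m * 2) + 1) % 2
  P? = λ k → k % 2 ≟ q
  q≡0 : q ≡ 0
  q≡0 = trans (cong (_% 2) (ℕ.+-comm (3 + m * 2) 1)) (m*n%n≡0 (2 + m) 2)
  3≢q : 3 % 2 ≢ q
  3≢q e = ℕ.1+n≢0 (trans e q≡0)

Tset-even : ∀ m → Tset (4 + m * 2) ≡ stride2 3 (suc m)
Tset-even m = begin
  filter P? (range 2 (3 + m * 2))            ≡⟨ cong (filter P?) (range-countFrom 2 (suc (m * 2))) ⟩
  filter P? (2 ∷ countFrom 3 (suc (m * 2)))  ≡⟨ List.filter-reject P? {2} 2≢q ⟩
  filter P? (countFrom 3 (suc (m * 2)))      ≡⟨ filter-parity-countFrom 3 m (sym q≡1) 2≢q ⟩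
  stride2 3 (suc m)                          ∎
  where
  q = ((4 + m * 2) + 1) % 2
  P? = λ k → k % 2 ≟ q
  q≡1 : q ≡ 1
  q≡1 = trans (cong (_% 2) (ℕ.+-comm (4 + m * 2) 1)) ([m+kn]%n≡m%n 1 (2 + m) 2)
  2≢q : 2 % 2 ≢ q
  2≢q e = ℕ.0≢1+n (trans e q≡1)

[1+m*2]/2≡m : ∀ m → suc (m * 2) / 2 ≡ m
[1+m*2]/2≡m zero = refl
[1+m*2]/2≡m (suc m) = trans (m/n≡1+[m∸n]/n {3 + m * 2} (s≤s (s≤s z≤n))) (cong suc ([1+m*2]/2≡m m))

length-stride2 : ∀ x j → length (stride2 x j) ≡ j
length-stride2 x zero = refl
length-stride2 x (suc j) = cong suc (length-stride2 (2 + x) j)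

stride2-lower : ∀ {x j k} → k ∈ stride2 x j → x ≤ k
stride2-lower {x} {suc j} (here refl) = ℕ.≤-refl
stride2-lower {x} {suc j} (there k∈) = ℕ.≤-trans (ℕ.m≤n+m x 2) (stride2-lower k∈)

negateFrom : ℕ → List ℤ → List ℤ
negateFrom i π = take i π ++ map -_ (drop i π)

map-neg-involutive : (l : List ℤ) → map -_ (map -_ l) ≡ l
map-neg-involutive l = trans (sym (List.map-∘ l)) (trans (List.map-cong ℤ.neg-involutive l) (List.map-id l))

map-abs-neg : (l : List ℤ) → map ∣_∣ (map -_ l) ≡ map ∣_∣ l
map-abs-neg l = trans (sym (List.map-∘ l)) (List.map-cong ℤ.∣-i∣≡∣i∣ l)

negateFrom-length : ∀ i π → length (negateFrom i π) ≡ length π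
negateFrom-length zero π = List.length-map -_ π
negateFrom-length (suc i) [] = refl
negateFrom-length (suc i) (x ∷ π) = cong suc (negateFrom-length i π)

negateFrom-abs : ∀ i π → map ∣_∣ (negateFrom i π) ≡ map ∣_∣ π
negateFrom-abs zero π = map-abs-neg π
negateFrom-abs (suc i) [] = refl
negateFrom-abs (suc i) (x ∷ π) = cong (∣ x ∣ ∷_) (negateFrom-abs i π)

negateFrom-involutive : ∀ i π → negateFrom i (negateFrom i π) ≡ π
negateFrom-involutive zero π = map-neg-involutive π
negateFrom-involutive (suc i) [] = refl
negateFrom-involutive (suc i) (x ∷ π) = cong (x ∷_) (negateFrom-involutive i π)

negateFrom-neg : ∀ i π → negateFrom i (map -_ π) ≡ map -_ (negateFrom i π)
negateFrom-neg zero π = refl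
negateFrom-neg (suc i) [] = refl
negateFrom-neg (suc i) (x ∷ π) = cong (- x ∷_) (negateFrom-neg i π)

negateFrom-comm : ∀ i j π → negateFrom i (negateFrom j π) ≡ negateFrom j (negateFrom i π)
negateFrom-comm zero zero π = refl
negateFrom-comm zero (suc j) π = sym (negateFrom-neg (suc j) π)
negateFrom-comm (suc i) zero π = negateFrom-neg (suc i) π
negateFrom-comm (suc i) (suc j) [] = refl
negateFrom-comm (suc i) (suc j) (x ∷ π) = cong (x ∷_) (negateFrom-comm i j π)

negateFrom-++ : ∀ p v → negateFrom (length p) (p ++ v) ≡ p ++ map -_ v
negateFrom-++ [] v = refl
negateFrom-++ (x ∷ p) v = cong (x ∷_) (negateFrom-++ p v)

sgnFlip-preserves-B> : ∀ {n k π} → 2 ≤ k → IsSignedPerm> n π → IsSignedPerm> n (sgnFlip k π)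
sgnFlip-preserves-B> {n} {suc (suc k)} {x ∷ π} (s≤s (s≤s _)) ((len , perm) , pos) =
  (trans (negateFrom-length (suc k) (x ∷ π)) len ,
   subst (_↭ range 1 n) (sym (negateFrom-abs (suc k) (x ∷ π))) perm) ,
  pos

negateIf : Bool → List ℤ → List ℤ
negateIf true = map -_
negateIf false l = l

flipPairs : List Bool → List ℤ → List ℤ
flipPairs (b ∷ e) (u ∷ w ∷ v) = negateIf b (u ∷ w ∷ flipPairs e v)
flipPairs _ v = v

flipPairs-neg : ∀ e v → flipPairs e (map -_ v) ≡ map -_ (flipPairs e v)
flipPairs-neg (false ∷ e) (u ∷ w ∷ v) = cong (λ r → - u ∷ - w ∷ r) (flipPairs-neg e v)
flipPairs-neg (true ∷ e) (u ∷ w ∷ v) = cong (λ r → - - u ∷ - - w ∷ map -_ r) (flipPairs-neg e v)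
flipPairs-neg [] v = refl
flipPairs-neg (b ∷ e) [] = refl
flipPairs-neg (b ∷ e) (u ∷ []) = refl

length-++-pair : ∀ (p : List ℤ) u w → 2 + length p ≡ length (p ++ u ∷ w ∷ [])
length-++-pair p u w = trans (ℕ.+-comm 2 (length p)) (sym (List.length-++ p))

act-stride2 : ∀ p e v → length v ≡ length e * 2 →
  act (stride2 (suc (length p)) (length e)) e (p ++ v) ≡ p ++ flipPairs e v
act-stride2 p [] v _ = refl
act-stride2 p (false ∷ e) (u ∷ w ∷ v) lv = begin
  act (stride2 (3 + length p) (length e)) e (p ++ u ∷ w ∷ v)
    ≡⟨ cong₂′ (length-++-pair p u w) (sym (List.++-assoc p (u ∷ w ∷ []) v)) ⟩
  act (stride2 (suc (length p′)) (length e)) e (p′ ++ v)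
    ≡⟨ act-stride2 p′ e v (ℕ.suc-injective (ℕ.suc-injective lv)) ⟩
  p′ ++ flipPairs e v
    ≡⟨ List.++-assoc p (u ∷ w ∷ []) (flipPairs e v) ⟩
  p ++ u ∷ w ∷ flipPairs e v ∎
  where
  p′ = p ++ u ∷ w ∷ []
  cong₂′ = cong₂ (λ k π → act (stride2 (suc k) (length e)) e π)
act-stride2 p (true ∷ e) (u ∷ w ∷ v) lv = begin
  act (stride2 (3 + length p) (length e)) e (negateFrom (length p) (p ++ u ∷ w ∷ v))
    ≡⟨ cong₂′ (length-++-pair p (- u) (- w))
         (trans (negateFrom-++ p (u ∷ w ∷ v)) (sym (List.++-assoc p (- u ∷ - w ∷ []) (map -_ v)))) ⟩
  act (stride2 (suc (length p′)) (length e)) e (p′ ++ map -_ v)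
    ≡⟨ act-stride2 p′ e (map -_ v) (trans (List.length-map -_ v) (ℕ.suc-injective (ℕ.suc-injective lv))) ⟩
  p′ ++ flipPairs e (map -_ v)
    ≡⟨ trans (List.++-assoc p (- u ∷ - w ∷ []) _) (cong (λ r → p ++ - u ∷ - w ∷ r) (flipPairs-neg e v)) ⟩
  p ++ flipPairs (true ∷ e) (u ∷ w ∷ v) ∎
  where
  p′ = p ++ - u ∷ - w ∷ []
  cong₂′ = cong₂ (λ k π → act (stride2 (suc k) (length e)) e π)

nonzero⇒≢neg : ∀ u → 0 ≢ ∣ u ∣ → u ≢ - u
nonzero⇒≢neg +0 0≢|u| _ = 0≢|u| refl
nonzero⇒≢neg +[1+ _ ] _ ()
nonzero⇒≢neg -[1+ _ ] _ ()

flipPairs-injective : ∀ e e′ v → length e ≡ length e′ → length v ≡ length e * 2 →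
  All (λ z → 0 ≢ ∣ z ∣) v → flipPairs e v ≡ flipPairs e′ v → e ≡ e′
flipPairs-injective [] [] v _ _ _ _ = refl
flipPairs-injective (false ∷ e) (false ∷ e′) (u ∷ w ∷ v) le lv (_ ∷ _ ∷ v≢0) eq =
  cong (false ∷_) (flipPairs-injective e e′ v (ℕ.suc-injective le) (ℕ.suc-injective (ℕ.suc-injective lv)) v≢0
    (List.∷-injectiveʳ (List.∷-injectiveʳ eq)))
flipPairs-injective (true ∷ e) (true ∷ e′) (u ∷ w ∷ v) le lv (_ ∷ _ ∷ v≢0) eq =
  cong (true ∷_) (flipPairs-injective e e′ v (ℕ.suc-injective le) (ℕ.suc-injective (ℕ.suc-injective lv)) v≢0
    (List.map-injective ℤ.neg-injective (List.∷-injectiveʳ (List.∷-injectiveʳ eq))))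
flipPairs-injective (false ∷ e) (true ∷ e′) (u ∷ w ∷ v) _ _ (u≢0 ∷ _) eq =
  ⊥-elim (nonzero⇒≢neg u u≢0 (List.∷-injectiveˡ eq))
flipPairs-injective (true ∷ e) (false ∷ e′) (u ∷ w ∷ v) _ _ (u≢0 ∷ _) eq =
  ⊥-elim (nonzero⇒≢neg u u≢0 (sym (List.∷-injectiveˡ eq)))

bit : Bool → ℕ
bit b = if b then 1 else 0

infix 7 _<ᵇ_
_<ᵇ_ : ℤ → ℤ → Bool
a <ᵇ b = ⌊ a <? b ⌋

<ᵇ-flip : ∀ a b → a ≢ b → b <ᵇ a ≡ not (a <ᵇ b)
<ᵇ-flip a b a≢b with a <? b | b <? a
... | yes a<b | yes b<a = ⊥-elim (ℤ.<-asym a<b b<a)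
... | yes _   | no _    = refl
... | no _    | yes _   = refl
... | no a≮b  | no b≮a with ℤ.<-cmp a b
...   | tri< a<b _ _ = ⊥-elim (a≮b a<b)
...   | tri≈ _ a≡b _ = ⊥-elim (a≢b a≡b)
...   | tri> _ _ b<a = ⊥-elim (b≮a b<a)

<ᵇ-neg : ∀ a b → - a <ᵇ - b ≡ b <ᵇ a
<ᵇ-neg a b with - a <? - b | b <? a
... | yes _   | yes _   = refl
... | no _    | no _    = refl
... | yes -a<-b | no b≮a = ⊥-elim (b≮a (ℤ.neg-cancel-< -a<-b))
... | no -a≮-b  | yes b<a = ⊥-elim (-a≮-b (ℤ.neg-mono-< b<a))

changesDir-xor : ∀ x y z → x ≢ y → y ≢ z → changesDir x y z ≡ (x <ᵇ y) xor (y <ᵇ z)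
changesDir-xor x y z x≢y y≢z = begin
  (x <ᵇ y ∧ z <ᵇ y) ∨ (y <ᵇ x ∧ y <ᵇ z)
    ≡⟨ cong₂ (λ s t → (x <ᵇ y ∧ s) ∨ (t ∧ y <ᵇ z)) (<ᵇ-flip y z y≢z) (<ᵇ-flip x y x≢y) ⟩
  (x <ᵇ y ∧ not (y <ᵇ z)) ∨ (not (x <ᵇ y) ∧ y <ᵇ z)
    ≡⟨ xor-as-∨ (x <ᵇ y) (y <ᵇ z) ⟩
  (x <ᵇ y) xor (y <ᵇ z) ∎
  where
  xor-as-∨ : ∀ p q → (p ∧ not q) ∨ (not p ∧ q) ≡ p xor q
  xor-as-∨ false q = refl
  xor-as-∨ true q = Bool.∨-identityʳ (not q)

changesDir-neg : ∀ x y z → changesDir (- x) (- y) (- z) ≡ changesDir x y z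
changesDir-neg x y z =
  trans (cong₂ _∨_ (cong₂ _∧_ (<ᵇ-neg x y) (<ᵇ-neg z y)) (cong₂ _∧_ (<ᵇ-neg y x) (<ᵇ-neg y z)))
        (Bool.∨-comm (y <ᵇ x ∧ y <ᵇ z) (x <ᵇ y ∧ z <ᵇ y))

countChanges-neg : ∀ l → countChanges (map -_ l) ≡ countChanges l
countChanges-neg (x ∷ y ∷ z ∷ l) = cong₂ _+_ (cong bit (changesDir-neg x y z)) (countChanges-neg (y ∷ z ∷ l))
countChanges-neg [] = refl
countChanges-neg (_ ∷ []) = refl
countChanges-neg (_ ∷ _ ∷ []) = refl

hamming : List Bool → List Bool → ℕ
hamming (b ∷ e) (d ∷ ds) = bit (b xor d) + hamming e ds
hamming _ _ = 0

-- The first sum has the parity of A xor Q and the second that of A xor not Q; they cannot be 0 and 2,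
-- since a sum 0 forces P = A = Q and a sum 2 forces P′ = Q ≠ A (and symmetrically).
xor-chain-differ-by-one : ∀ A P P′ Q → ∃₂ λ a d →
  bit (A xor P) + bit (P xor Q) ≡ a + bit d × bit (A xor P′) + bit (P′ xor not Q) ≡ a + bit (not d)
xor-chain-differ-by-one false false false false = 0 , false , refl , refl
xor-chain-differ-by-one false false false true  = 0 , true  , refl , refl
xor-chain-differ-by-one false false true  false = 0 , false , refl , refl
xor-chain-differ-by-one false false true  true  = 1 , false , refl , refl
xor-chain-differ-by-one false true  false false = 1 , true  , refl , refl
xor-chain-differ-by-one false true  false true  = 0 , true  , refl , refl
xor-chain-differ-by-one false true  true  false = 1 , true  , refl , refl
xor-chain-differ-by-one false true  true  true  = 1 , false , refl , refl
xor-chain-differ-by-one true  false false false = 1 , false , refl , refl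
xor-chain-differ-by-one true  false false true  = 1 , true  , refl , refl
xor-chain-differ-by-one true  false true  false = 0 , true  , refl , refl
xor-chain-differ-by-one true  false true  true  = 1 , true  , refl , refl
xor-chain-differ-by-one true  true  false false = 1 , false , refl , refl
xor-chain-differ-by-one true  true  false true  = 0 , false , refl , refl
xor-chain-differ-by-one true  true  true  false = 0 , true  , refl , refl
xor-chain-differ-by-one true  true  true  true  = 0 , false , refl , refl

changesDir-pair-flip : ∀ x y u w → ∣ x ∣ ≢ ∣ y ∣ → ∣ y ∣ ≢ ∣ u ∣ → ∣ u ∣ ≢ ∣ w ∣ →
  ∃₂ λ a d →
  bit (changesDir x y u) + bit (changesDir y u w) ≡ a + bit d ×
  bit (changesDir x y (- u)) + bit (changesDir y (- u) (- w)) ≡ a + bit (not d)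
changesDir-pair-flip x y u w |x|≢|y| |y|≢|u| |u|≢|w|
  with xor-chain-differ-by-one (x <ᵇ y) (y <ᵇ u) (y <ᵇ - u) (u <ᵇ w)
... | a , d , unflipped , flipped = a , d ,
  trans (cong₂ _+_ (cong bit (changesDir-xor x y u x≢y y≢u)) (cong bit (changesDir-xor y u w y≢u u≢w)))
        unflipped ,
  trans (cong₂ _+_ (cong bit (changesDir-xor x y (- u) x≢y y≢-u))
                   (cong bit (trans (changesDir-xor y (- u) (- w) y≢-u -u≢-w)
                                    (cong (y <ᵇ - u xor_) (trans (<ᵇ-neg u w) (<ᵇ-flip u w u≢w))))))
        flipped
  where
  x≢y : x ≢ y
  x≢y = |x|≢|y| ∘ cong ∣_∣
  y≢u : y ≢ u
  y≢u = |y|≢|u| ∘ cong ∣_∣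
  y≢-u : y ≢ - u
  y≢-u y≡-u = |y|≢|u| (trans (cong ∣_∣ y≡-u) (ℤ.∣-i∣≡∣i∣ u))
  u≢w : u ≢ w
  u≢w = |u|≢|w| ∘ cong ∣_∣
  -u≢-w : - u ≢ - w
  -u≢-w = u≢w ∘ ℤ.neg-injective

countChanges-flipPairs : ∀ r x y v → length v ≡ r * 2 → Unique (map ∣_∣ (x ∷ y ∷ v)) →
  ∃₂ λ a d → length d ≡ r × (∀ e → length e ≡ r → countChanges (x ∷ y ∷ flipPairs e v) ≡ a + hamming e d)
countChanges-flipPairs zero x y [] _ _ = 0 , [] , refl , λ { [] _ → refl }
countChanges-flipPairs (suc r) x y (u ∷ w ∷ v) lv
  ((|x|≢|y| ∷ _) ∷ (|y|≢|u| ∷ _) ∷ !uwv@((|u|≢|w| ∷ _) ∷ _))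
  with changesDir-pair-flip x y u w |x|≢|y| |y|≢|u| |u|≢|w|
     | countChanges-flipPairs r u w v (ℕ.suc-injective (ℕ.suc-injective lv)) !uwv
... | a₀ , d₀ , unflipped , flipped | a , d , ld , changes-tail = a₀ + a , d₀ ∷ d , cong suc ld , changes
  where
  combine : ∀ c₁ c₂ {β R h} → c₁ + c₂ ≡ a₀ + β → R ≡ a + h →
            c₁ + (c₂ + R) ≡ (a₀ + a) + (β + h)
  combine c₁ c₂ {β} {R} {h} local tail = begin
    c₁ + (c₂ + R)         ≡⟨ ℕ.+-assoc c₁ c₂ R ⟨
    (c₁ + c₂) + R         ≡⟨ cong₂ _+_ local tail ⟩
    (a₀ + β) + (a + h)    ≡⟨ interchange a₀ β a h ⟩
    (a₀ + a) + (β + h)    ∎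
  changes : ∀ e → length e ≡ suc r →
            countChanges (x ∷ y ∷ flipPairs e (u ∷ w ∷ v)) ≡ (a₀ + a) + hamming e (d₀ ∷ d)
  changes (false ∷ e) le = combine (bit (changesDir x y u)) (bit (changesDir y u w)) unflipped
    (changes-tail e (ℕ.suc-injective le))
  changes (true ∷ e) le = combine (bit (changesDir x y (- u))) (bit (changesDir y (- u) (- w))) flipped
    (trans (countChanges-neg (u ∷ w ∷ flipPairs e v)) (changes-tail e (ℕ.suc-injective le)))

fibreSize : {A : Set} → (A → ℕ) → ℕ → List A → ℕ
fibreSize g j xs = length (filter (λ x → g x ≟ j) xs)

δ : ℕ → ℕ → ℕ
δ i j = bit (does (i ≟ j))

fibreSize-∷ : ∀ {A : Set} (g : A → ℕ) j x xs → fibreSize g j (x ∷ xs) ≡ δ (g x) j + fibreSize g j xs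
fibreSize-∷ g j x xs with does (g x ≟ j)
... | true = refl
... | false = refl

fibreSize-map : ∀ {A B : Set} (g : B → ℕ) (f : A → B) j xs →
  fibreSize g j (map f xs) ≡ fibreSize (λ x → g (f x)) j xs
fibreSize-map g f j [] = refl
fibreSize-map g f j (x ∷ xs) = begin
  fibreSize g j (f x ∷ map f xs)                 ≡⟨ fibreSize-∷ g j (f x) (map f xs) ⟩
  δ (g (f x)) j + fibreSize g j (map f xs)        ≡⟨ cong (δ (g (f x)) j +_) (fibreSize-map g f j xs) ⟩
  δ (g (f x)) j + fibreSize (λ x → g (f x)) j xs  ≡⟨ fibreSize-∷ (λ x → g (f x)) j x xs ⟨
  fibreSize (λ x → g (f x)) j (x ∷ xs)           ∎

fibreSize-cong : ∀ {A : Set} {g h : A → ℕ} j xs → (∀ x → x ∈ xs → g x ≡ h x) →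
  fibreSize g j xs ≡ fibreSize h j xs
fibreSize-cong j [] g≗h = refl
fibreSize-cong {g = g} {h} j (x ∷ xs) g≗h = begin
  fibreSize g j (x ∷ xs)         ≡⟨ fibreSize-∷ g j x xs ⟩
  δ (g x) j + fibreSize g j xs   ≡⟨ cong₂ (λ a b → δ a j + b) (g≗h x (here refl))
                                           (fibreSize-cong j xs (λ y y∈ → g≗h y (there y∈))) ⟩
  δ (h x) j + fibreSize h j xs   ≡⟨ fibreSize-∷ h j x xs ⟨
  fibreSize h j (x ∷ xs)         ∎

prependBit : List Bool → List (List Bool)
prependBit bs = (false ∷ bs) ∷ (true ∷ bs) ∷ []

fibreSize-prependBit : ∀ (g : List Bool → ℕ) j L →
  fibreSize g j (concatMap prependBit L)
    ≡ fibreSize (λ t → g (false ∷ t)) j L + fibreSize (λ t → g (true ∷ t)) j L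
fibreSize-prependBit g j [] = refl
fibreSize-prependBit g j (t ∷ L) = begin
  fibreSize g j ((false ∷ t) ∷ (true ∷ t) ∷ concatMap prependBit L)
    ≡⟨ trans (fibreSize-∷ g j _ _) (cong (δ (g (false ∷ t)) j +_) (fibreSize-∷ g j _ _)) ⟩
  δ₀ + (δ₁ + fibreSize g j (concatMap prependBit L))
    ≡⟨ cong (λ r → δ₀ + (δ₁ + r)) (fibreSize-prependBit g j L) ⟩
  δ₀ + (δ₁ + (F₀ + F₁))
    ≡⟨ trans (sym (ℕ.+-assoc δ₀ δ₁ (F₀ + F₁))) (interchange δ₀ δ₁ F₀ F₁) ⟩
  (δ₀ + F₀) + (δ₁ + F₁)
    ≡⟨ cong₂ _+_ (fibreSize-∷ (λ t → g (false ∷ t)) j t L)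
                 (fibreSize-∷ (λ t → g (true ∷ t)) j t L) ⟨
  fibreSize (λ t → g (false ∷ t)) j (t ∷ L) + fibreSize (λ t → g (true ∷ t)) j (t ∷ L) ∎
  where
  δ₀ = δ (g (false ∷ t)) j
  δ₁ = δ (g (true ∷ t)) j
  F₀ = fibreSize (λ t → g (false ∷ t)) j L
  F₁ = fibreSize (λ t → g (true ∷ t)) j L

shiftedBinomCoeff-suc : ∀ c m j → shiftedBinomCoeff (suc c) m (suc j) ≡ shiftedBinomCoeff c m j
shiftedBinomCoeff-suc zero m j = refl
shiftedBinomCoeff-suc (suc c) m j = refl

shiftedBinomCoeff-zero : ∀ c j → shiftedBinomCoeff c 0 j ≡ δ c j
shiftedBinomCoeff-zero zero zero = refl
shiftedBinomCoeff-zero zero (suc j) = refl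
shiftedBinomCoeff-zero (suc c) zero = refl
shiftedBinomCoeff-zero (suc c) (suc j) = trans (shiftedBinomCoeff-suc c 0 j) (shiftedBinomCoeff-zero c j)

shiftedBinomCoeff-pascal : ∀ c m j →
  shiftedBinomCoeff c (suc m) j ≡ shiftedBinomCoeff c m j + shiftedBinomCoeff (suc c) m j
shiftedBinomCoeff-pascal zero m zero = refl
shiftedBinomCoeff-pascal zero m (suc j) = trans (sym (nCk+nC[k+1]≡[n+1]C[k+1] m j)) (ℕ.+-comm (m C j) (m C suc j))
shiftedBinomCoeff-pascal (suc c) m zero = refl
shiftedBinomCoeff-pascal (suc c) m (suc j) = begin
  shiftedBinomCoeff (suc c) (suc m) (suc j)
    ≡⟨ shiftedBinomCoeff-suc c (suc m) j ⟩
  shiftedBinomCoeff c (suc m) j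
    ≡⟨ shiftedBinomCoeff-pascal c m j ⟩
  shiftedBinomCoeff c m j + shiftedBinomCoeff (suc c) m j
    ≡⟨ cong₂ _+_ (shiftedBinomCoeff-suc c m j) (shiftedBinomCoeff-suc (suc c) m j) ⟨
  shiftedBinomCoeff (suc c) m (suc j) + shiftedBinomCoeff (2 + c) m (suc j) ∎

fibreSize-hamming : ∀ c d j →
  fibreSize (λ e → c + hamming e d) j (allBools (length d)) ≡ shiftedBinomCoeff c (length d) j
fibreSize-hamming c [] j = begin
  fibreSize (λ e → c + hamming e []) j ([] ∷ [])  ≡⟨ fibreSize-∷ (λ e → c + hamming e []) j [] [] ⟩
  δ (c + 0) j + 0                                  ≡⟨ ℕ.+-identityʳ _ ⟩
  δ (c + 0) j                                      ≡⟨ cong (λ i → δ i j) (ℕ.+-identityʳ c) ⟩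
  δ c j                                            ≡⟨ shiftedBinomCoeff-zero c j ⟨
  shiftedBinomCoeff c 0 j                          ∎
fibreSize-hamming c (d₀ ∷ d) j = begin
  fibreSize g j (concatMap prependBit A)
    ≡⟨ fibreSize-prependBit g j A ⟩
  fibreSize (λ t → g (false ∷ t)) j A + fibreSize (λ t → g (true ∷ t)) j A
    ≡⟨ split d₀ ⟩
  F c + F (suc c)
    ≡⟨ cong₂ _+_ (fibreSize-hamming c d j) (fibreSize-hamming (suc c) d j) ⟩
  shiftedBinomCoeff c (length d) j + shiftedBinomCoeff (suc c) (length d) j
    ≡⟨ shiftedBinomCoeff-pascal c (length d) j ⟨
  shiftedBinomCoeff c (suc (length d)) j ∎
  where
  g = λ e → c + hamming e (d₀ ∷ d)
  A = allBools (length d)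
  F : ℕ → ℕ
  F c′ = fibreSize (λ t → c′ + hamming t d) j A
  one-more : fibreSize (λ t → c + suc (hamming t d)) j A ≡ F (suc c)
  one-more = fibreSize-cong j A (λ t _ → ℕ.+-suc c (hamming t d))
  split : ∀ d₀ → fibreSize (λ t → c + (bit (false xor d₀) + hamming t d)) j A
               + fibreSize (λ t → c + (bit (true xor d₀) + hamming t d)) j A ≡ F c + F (suc c)
  split false = cong (F c +_) one-more
  split true = trans (ℕ.+-comm (fibreSize (λ t → c + suc (hamming t d)) j A) (F c)) (cong (F c +_) one-more)

∈-concatMap-prependBit⁻ : ∀ {L e} → e ∈ concatMap prependBit L → ∃₂ λ b t → e ≡ b ∷ t × t ∈ L
∈-concatMap-prependBit⁻ {L} e∈ with find (∈-concatMap⁻ prependBit {xs = L} e∈)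
... | t , t∈ , here refl = false , t , refl , t∈
... | t , t∈ , there (here refl) = true , t , refl , t∈

∈-allBools⇒length : ∀ m {e} → e ∈ allBools m → length e ≡ m
∈-allBools⇒length zero (here refl) = refl
∈-allBools⇒length (suc m) e∈ with ∈-concatMap-prependBit⁻ {allBools m} e∈
... | _ , _ , refl , t∈ = cong suc (∈-allBools⇒length m t∈)

allBools-unique : ∀ m → Unique (allBools m)
allBools-unique zero = [] ∷ []
allBools-unique (suc m) = prepend-unique (allBools-unique m)
  where
  prepend-unique : ∀ {L} → Unique L → Unique (concatMap prependBit L)
  prepend-unique {[]} [] = []
  prepend-unique {t ∷ L} (t∉L ∷ !L) =
    ((λ ()) ∷ All.tabulate (fresh false)) ∷ All.tabulate (fresh true) ∷ prepend-unique !L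
    where
    fresh : ∀ b {e} → e ∈ concatMap prependBit L → b ∷ t ≢ e
    fresh b e∈ refl with ∈-concatMap-prependBit⁻ {L} e∈
    ... | _ , _ , refl , t∈L = All.lookup t∉L t∈L refl

deduplicate-unique : ∀ {A : Set} (_≟_ : DecidableEquality A) {xs} → Unique xs → deduplicate _≟_ xs ≡ xs
deduplicate-unique _≟_ {[]} [] = refl
deduplicate-unique _≟_ {x ∷ xs} (x∉xs ∷ !xs) =
  cong (x ∷_) (trans (cong (filter (¬? ∘ (x ≟_))) (deduplicate-unique _≟_ !xs))
                     (List.filter-all (¬? ∘ (x ≟_)) x∉xs))

map-unique-injectiveOn : ∀ {A B : Set} (f : A → B) {xs} →
  (∀ {x y} → x ∈ xs → y ∈ xs → f x ≡ f y → x ≡ y) → Unique xs → Unique (map f xs)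
map-unique-injectiveOn f {[]} inj [] = []
map-unique-injectiveOn f {x ∷ xs} inj (x∉xs ∷ !xs) =
  All.map⁺ (All.tabulate λ y∈ fx≡fy → All.lookup x∉xs y∈ (inj (here refl) (there y∈) fx≡fy))
  ∷ map-unique-injectiveOn f (λ x∈ y∈ → inj (there x∈) (there y∈)) !xs

orbitCoeff-flipPairs : ∀ n (p v : List ℤ) a d r →
  Tset n ≡ stride2 (suc (length p)) r → length v ≡ r * 2 → length d ≡ r → All (λ z → 0 ≢ ∣ z ∣) v →
  (∀ e → length e ≡ r → altrunsB (p ++ flipPairs e v) ≡ a + hamming e d) →
  ∀ j → orbitCoeff (orbit n (p ++ v)) j ≡ shiftedBinomCoeff a (length (Tset n)) j
orbitCoeff-flipPairs n p v a d r T≡ lv refl v≢0 altruns j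
  rewrite T≡ | length-stride2 (suc (length p)) (length d) = begin
  fibreSize altrunsB j (deduplicate (List.≡-dec ℤ._≟_) (map f A))
    ≡⟨ cong (fibreSize altrunsB j) (deduplicate-unique (List.≡-dec ℤ._≟_) orbit-unique) ⟩
  fibreSize altrunsB j (map f A)
    ≡⟨ fibreSize-map altrunsB f j A ⟩
  fibreSize (λ e → altrunsB (f e)) j A
    ≡⟨ fibreSize-cong j A (λ e e∈ → trans (cong altrunsB (f≡ e∈)) (altruns e (length∈A e∈))) ⟩
  fibreSize (λ e → a + hamming e d) j A
    ≡⟨ fibreSize-hamming a d j ⟩
  shiftedBinomCoeff a (length d) j ∎
  where
  A = allBools (length d)
  length∈A : ∀ {e} → e ∈ A → length e ≡ length d
  length∈A = ∈-allBools⇒length (length d)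
  f : List Bool → List ℤ
  f e = act (stride2 (suc (length p)) (length d)) e (p ++ v)
  f≡ : ∀ {e} → e ∈ A → f e ≡ p ++ flipPairs e v
  f≡ {e} e∈ = subst (λ k → act (stride2 (suc (length p)) k) e (p ++ v) ≡ p ++ flipPairs e v) (length∈A e∈)
    (act-stride2 p e v (trans lv (cong (_* 2) (sym (length∈A e∈)))))
  orbit-unique : Unique (map f A)
  orbit-unique = map-unique-injectiveOn f
    (λ x∈ y∈ fx≡fy → flipPairs-injective _ _ v (trans (length∈A x∈) (sym (length∈A y∈)))
       (trans lv (cong (_* 2) (sym (length∈A x∈)))) v≢0
       (List.++-cancelˡ p _ _ (trans (sym (f≡ x∈)) (trans fx≡fy (f≡ y∈)))))
    (allBools-unique (length d))

countFrom-lower : ∀ x c → All (x ≤_) (countFrom x c)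
countFrom-lower x zero = []
countFrom-lower x (suc c) = ℕ.≤-refl ∷ All.map (ℕ.≤-trans (ℕ.n≤1+n x)) (countFrom-lower (suc x) c)

countFrom-unique : ∀ x c → Unique (countFrom x c)
countFrom-unique x zero = []
countFrom-unique x (suc c) = All.map ℕ.<⇒≢ (countFrom-lower (suc x) c) ∷ countFrom-unique (suc x) c

-- 0 ∷ range 1 n reduces to range 0 n.
signedPerm-abs-unique : ∀ n π → IsSignedPerm n π → Unique (map ∣_∣ (+0 ∷ π))
signedPerm-abs-unique n π (_ , perm) =
  Perm.Unique-resp-↭ (setoid ℕ) (↭⇒↭ₛ (↭-sym (prep 0 perm)))
    (subst Unique (sym (range-countFrom 0 n)) (countFrom-unique 0 (suc n)))

absUnique⇒nonzero : ∀ {π} → Unique (map ∣_∣ (+0 ∷ π)) → All (λ z → 0 ≢ ∣ z ∣) π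
absUnique⇒nonzero (0∉ ∷ _) = All.map⁻ 0∉

orbitCoeff-odd : ∀ m π → IsSignedPerm> (3 + m * 2) π → ∃ λ a → ∀ j →
  orbitCoeff (orbit (3 + m * 2) π) j ≡ shiftedBinomCoeff a (length (Tset (3 + m * 2))) j
orbitCoeff-odd m (π₁ ∷ v) (sp@(len , _) , _)
  with signedPerm-abs-unique (3 + m * 2) (π₁ ∷ v) sp
... | !π with countChanges-flipPairs (suc m) +0 π₁ v (ℕ.suc-injective len) !π
... | a , d , ld , changes = suc a ,
  orbitCoeff-flipPairs (3 + m * 2) (π₁ ∷ []) v (suc a) d (suc m) (Tset-odd m) (ℕ.suc-injective len) ld
    (All.tail (absUnique⇒nonzero {π₁ ∷ v} !π)) (λ e le → cong suc (changes e le))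

orbitCoeff-even : ∀ m π → IsSignedPerm> (4 + m * 2) π → ∃ λ a → ∀ j →
  orbitCoeff (orbit (4 + m * 2) π) j ≡ shiftedBinomCoeff a (length (Tset (4 + m * 2))) j
orbitCoeff-even m (π₁ ∷ π₂ ∷ v) (sp@(len , _) , _)
  with signedPerm-abs-unique (4 + m * 2) (π₁ ∷ π₂ ∷ v) sp
... | !π@(_ ∷ !π-tail)
  with countChanges-flipPairs (suc m) π₁ π₂ v (ℕ.suc-injective (ℕ.suc-injective len)) !π-tail
... | a , d , ld , changes = suc (c + a) ,
  orbitCoeff-flipPairs (4 + m * 2) (π₁ ∷ π₂ ∷ []) v (suc (c + a)) d (suc m) (Tset-even m)
    (ℕ.suc-injective (ℕ.suc-injective len)) ld
    (All.tail (All.tail (absUnique⇒nonzero {π₁ ∷ π₂ ∷ v} !π)))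
    (λ e le → cong suc (trans (cong (c +_) (changes e le)) (sym (ℕ.+-assoc c a (hamming e d)))))
  where
  c = bit (changesDir +0 π₁ π₂)

sgnFlip-involution-B> : ∀ {n x j} → 2 ≤ x → Tset n ≡ stride2 x j →
  ∀ k → k ∈ Tset n → (π : List ℤ) → IsSignedPerm> n π →
  IsSignedPerm> n (sgnFlip k π) × sgnFlip k (sgnFlip k π) ≡ π
sgnFlip-involution-B> 2≤x T≡ k k∈T π π∈B =
  sgnFlip-preserves-B> (ℕ.≤-trans 2≤x (stride2-lower (subst (k ∈_) T≡ k∈T))) π∈B ,
  negateFrom-involutive (k ∸ 1) π

lemma9 : (n : ℕ) → 3 ≤ n →
    (length (Tset n) ≡ (n ∸ 1) / 2)
    × (∀ k → k ∈ Tset n → (π : List ℤ) → IsSignedPerm> n π →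
         IsSignedPerm> n (sgnFlip k π) × sgnFlip k (sgnFlip k π) ≡ π)
    × (∀ k l → k ∈ Tset n → l ∈ Tset n → (π : List ℤ) → IsSignedPerm> n π →
         sgnFlip k (sgnFlip l π) ≡ sgnFlip l (sgnFlip k π))
    × ((π : List ℤ) → IsSignedPerm> n π →
         ∃ λ (a : ℕ) → ∀ (j : ℕ) →
           orbitCoeff (orbit n π) j ≡ shiftedBinomCoeff a (length (Tset n)) j)
lemma9 (suc (suc (suc n))) (s≤s (s≤s (s≤s _))) with parity n
... | even m =
  trans (cong length (Tset-odd m)) (trans (length-stride2 2 (suc m)) (sym (m*n/n≡m (suc m) 2))) ,
  sgnFlip-involution-B> ℕ.≤-refl (Tset-odd m) ,
  (λ k l _ _ π _ → negateFrom-comm (k ∸ 1) (l ∸ 1) π) ,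
  orbitCoeff-odd m
... | odd m =
  trans (cong length (Tset-even m)) (trans (length-stride2 3 (suc m)) (sym ([1+m*2]/2≡m (suc m)))) ,
  sgnFlip-involution-B> (ℕ.n≤1+n 2) (Tset-even m) ,
  (λ k l _ _ π _ → negateFrom-comm (k ∸ 1) (l ∸ 1) π) ,
  orbitCoeff-even m
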